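{- The class ${BiG}^{\ast}_{\mathrm{fin}}$ is $\Sigma_1$-interpretable with parameters in the class ${2Eq}_{\mathrm{fin}}$.
   Context: Signatures contain no function symbols. ${BiG}^{\ast}_{\mathrm{fin}}$ is the class of all finite structures in the signature $\{L^1,R^1,E^2\}$ satisfying $\forall x\,(L(x)\leftrightarrow\neg R(x))\wedge\forall x\forall y\,(E(x,y)\to L(x)\wedge R(y))$ (finite bipartite graphs) in which each of $L$ and $R$ contains at least three elements. ${2Eq}_{\mathrm{fin}}$ is the class of all finite structures in the signature $\{P^2,Q^2\}$ in which both $P$ and $Q$ are equivalence relations. A $\sigma_2$-scheme in $\sigma_1$ is a collection of $\sigma_2$-formulas $\Phi_U(x,\bar y)$ and, for each $n$-ary predicate symbol $R$ of $\sigma_1$, formulas $\Phi_R(x_1,\dots,x_n,\bar y)$ and $\Phi_{\neg R}(x_1,\dots,x_n,\bar y)$, where $\bar y$ is a fixed tuple of variables. For $\mathcal{K}_1$ a class of $\sigma_1$-structures and $\mathcal{K}_2$ a class of $\sigma_2$-structures, $\mathcal{K}_1$ is interpretable with parameters in $\mathcal{K}_2$ if there is a $\sigma_2$-scheme in $\sigma_1$ such that for every $\mathfrak{A}\in\mathcal{K}_1$ there are $\mathfrak{B}\in\mathcal{K}_2$ and a tuple $\bar p$ from $B$ with: (1) $B':=\{b\in B:\mathfrak{B}\models\Phi_U(b,\bar p)\}$ is nonempty; (2) for every $n$-ary predicate symbol $R$ of $\sigma_1$ and all $(b_1,\dots,b_n)\in (B')^n$, $\mathfrak{B}\models\Phi_{\neg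 R}(\bar b,\bar p)$ iff $\mathfrak{B}\not\models\Phi_R(\bar b,\bar p)$; (3) $\mathfrak{A}$ is isomorphic to the $\sigma_1$-structure $\mathfrak{B}'$ with universe $B'$ in which each $R$ is interpreted by $\mathfrak{B}'\models R(\bar b)$ iff $\mathfrak{B}\models\Phi_R(\bar b,\bar p)$. It is $\Sigma_k$-interpretable with parameters if moreover all formulas of the scheme are $\Sigma_k$-formulas (prenex formulas with exactly $k$ alternating quantifier blocks starting with $\exists$ and quantifier-free matrix). If $\bar y$ is empty, one says "interpretable" (without parameters). -}

module Defs where

open import Level using (0ℓ)
open import Data.Nat using (ℕ; zero; suc; _+_)
open import Data.Fin using (Fin)
open import Data.Vec using (Vec; []; _∷_; lookup; map; _++_)
open import Data.Vec.Relation.Unary.All using (All)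
open import Data.Bool using (Bool; true; false)
open import Data.Product using (Σ; ∃; _×_; _,_; proj₁)
open import Data.Sum using (_⊎_)
open import Relation.Nullary using (¬_)
open import Relation.Binary.PropositionalEquality using (_≡_; _≢_)
open import Function.Bundles using (_⇔_; _↔_)
open import Function.Definitions using (Injective)

record Signature : Set₁ where
  field
    Sym   : Set
    arity : Sym → ℕ
open Signature public

-- Structures: finite structures have decidable (Bool-valued) relations.
record Structure (σ : Signature) : Set₁ where
  field
    Carrier : Set
    rel     : (s : Sym σ) → Vec Carrier (arity σ s) → Bool
open Structure public

Finite : ∀ {σ} → Structure σ → Set
Finite 𝔄 = Σ ℕ λ k → Carrier 𝔄 ↔ Fin k

-- First-order formulas with equality, variables as de Bruijn indices
-- in a context of size n (variable zero = most recently bound).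

data Formula (σ : Signature) : ℕ → Set where
  atom : ∀ {n} (s : Sym σ) → Vec (Fin n) (arity σ s) → Formula σ n
  _≐_  : ∀ {n} → Fin n → Fin n → Formula σ n
  ¬'_  : ∀ {n} → Formula σ n → Formula σ n
  _∧'_ : ∀ {n} → Formula σ n → Formula σ n → Formula σ n
  _∨'_ : ∀ {n} → Formula σ n → Formula σ n → Formula σ n
  ∃'_  : ∀ {n} → Formula σ (suc n) → Formula σ n
  ∀'_  : ∀ {n} → Formula σ (suc n) → Formula σ n

Sat : ∀ {σ n} (𝔅 : Structure σ) → Formula σ n → Vec (Carrier 𝔅) n → Set
Sat 𝔅 (atom s xs) env = rel 𝔅 s (map (λ i → lookup env i) xs) ≡ true
Sat 𝔅 (i ≐ j)     env = lookup env i ≡ lookup env j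
Sat 𝔅 (¬' φ)      env = ¬ Sat 𝔅 φ env
Sat 𝔅 (φ ∧' ψ)    env = Sat 𝔅 φ env × Sat 𝔅 ψ env
Sat 𝔅 (φ ∨' ψ)    env = Sat 𝔅 φ env ⊎ Sat 𝔅 ψ env
Sat 𝔅 (∃' φ)      env = Σ (Carrier 𝔅) λ b → Sat 𝔅 φ (b ∷ env)
Sat 𝔅 (∀' φ)      env = (b : Carrier 𝔅) → Sat 𝔅 φ (b ∷ env)

data QF {σ} : ∀ {n} → Formula σ n → Set where
  qf-atom : ∀ {n} s (xs : Vec (Fin n) (arity σ s)) → QF (atom s xs)
  qf-eq   : ∀ {n} (i j : Fin n) → QF (i ≐ j)
  qf-neg  : ∀ {n} {φ : Formula σ n} → QF φ → QF (¬' φ)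
  qf-and  : ∀ {n} {φ ψ : Formula σ n} → QF φ → QF ψ → QF (φ ∧' ψ)
  qf-or   : ∀ {n} {φ ψ : Formula σ n} → QF φ → QF ψ → QF (φ ∨' ψ)

data IsΣ₁ {σ} : ∀ {n} → Formula σ n → Set where
  Σ₁-base : ∀ {n} {φ : Formula σ (suc n)} → QF φ → IsΣ₁ (∃' φ)
  Σ₁-step : ∀ {n} {φ : Formula σ (suc n)} → IsΣ₁ φ → IsΣ₁ (∃' φ)

-- σ₂-schemes in σ₁ with ℓ parameter variables ȳ.
-- Φ_U has free variables (x, ȳ), Φ_R has free variables (x₁..xₙ, ȳ);
-- the parameters occupy the last ℓ positions of the context.

record Scheme (σ₂ σ₁ : Signature) (ℓ : ℕ) : Set where
  field
    ΦU   : Formula σ₂ (suc ℓ)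
    ΦR   : (s : Sym σ₁) → Formula σ₂ (arity σ₁ s + ℓ)
    Φ¬R  : (s : Sym σ₁) → Formula σ₂ (arity σ₁ s + ℓ)
open Scheme public

SchemeΣ₁ : ∀ {σ₂ σ₁ ℓ} → Scheme σ₂ σ₁ ℓ → Set
SchemeΣ₁ {σ₁ = σ₁} S =
  IsΣ₁ (ΦU S) × ((s : Sym σ₁) → IsΣ₁ (ΦR S s) × IsΣ₁ (Φ¬R S s))

-- 𝔄 is interpreted in 𝔅 via scheme S with parameters p̄:
-- conditions (1), (2), (3), where the isomorphism 𝔄 ≅ 𝔅' is given as an
-- injective map 𝔄 → B whose image is exactly B' and which transports
-- the relations of 𝔄 to those defined by Φ_R.
Interprets : ∀ {σ₁ σ₂ ℓ} → Scheme σ₂ σ₁ ℓ →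
             (𝔄 : Structure σ₁) (𝔅 : Structure σ₂) → Vec (Carrier 𝔅) ℓ → Set
Interprets {σ₁} S 𝔄 𝔅 p =
  let inU = λ (b : Carrier 𝔅) → Sat 𝔅 (ΦU S) (b ∷ p) in
  (Σ (Carrier 𝔅) inU)
  × ((s : Sym σ₁) (bs : Vec (Carrier 𝔅) (arity σ₁ s)) → All inU bs →
       (Sat 𝔅 (Φ¬R S s) (bs ++ p) ⇔ (¬ Sat 𝔅 (ΦR S s) (bs ++ p))))
  × (Σ (Carrier 𝔄 → Carrier 𝔅) λ f →
        Injective _≡_ _≡_ f
      × ((a : Carrier 𝔄) → inU (f a))
      × ((b : Carrier 𝔅) → inU b → Σ (Carrier 𝔄) λ a → f a ≡ b)
      × ((s : Sym σ₁) (as : Vec (Carrier 𝔄) (arity σ₁ s)) →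
           (rel 𝔄 s as ≡ true) ⇔ Sat 𝔅 (ΦR S s) (map f as ++ p)))

Σ₁-InterpretableWithParams : ∀ {σ₁ σ₂} →
  (Structure σ₁ → Set) → (Structure σ₂ → Set) → Set₁
Σ₁-InterpretableWithParams {σ₁} {σ₂} K₁ K₂ =
  Σ ℕ λ ℓ → Σ (Scheme σ₂ σ₁ ℓ) λ S → SchemeΣ₁ S ×
    ((𝔄 : Structure σ₁) → K₁ 𝔄 →
      Σ (Structure σ₂) λ 𝔅 → K₂ 𝔅 ×
        Σ (Vec (Carrier 𝔅) ℓ) λ p → Interprets S 𝔄 𝔅 p)

data BiGSym : Set where L R E : BiGSym

BiGSig : Signature
BiGSig = record { Sym = BiGSym ; arity = ar }
  where
  ar : BiGSym → ℕ
  ar L = 1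
  ar R = 1
  ar E = 2

data EqSym : Set where P Q : EqSym

2EqSig : Signature
2EqSig = record { Sym = EqSym ; arity = λ _ → 2 }

AtLeast3 : {A : Set} → (A → Set) → Set
AtLeast3 {A} U = Σ A λ a → Σ A λ b → Σ A λ c →
  U a × U b × U c × a ≢ b × a ≢ c × b ≢ c

BiG*fin : Structure BiGSig → Set
BiG*fin 𝔄 =
  Finite 𝔄
  × ((x : Carrier 𝔄) → (rel 𝔄 L (x ∷ []) ≡ true) ⇔ (¬ rel 𝔄 R (x ∷ []) ≡ true))
  × ((x y : Carrier 𝔄) → rel 𝔄 E (x ∷ y ∷ []) ≡ true →
       (rel 𝔄 L (x ∷ []) ≡ true) × (rel 𝔄 R (y ∷ []) ≡ true))
  × AtLeast3 (λ x → rel 𝔄 L (x ∷ []) ≡ true)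
  × AtLeast3 (λ x → rel 𝔄 R (x ∷ []) ≡ true)

IsEquivRel : {A : Set} → (A → A → Bool) → Set
IsEquivRel {A} r =
    ((x : A) → r x x ≡ true)
  × ((x y : A) → r x y ≡ true → r y x ≡ true)
  × ((x y z : A) → r x y ≡ true → r y z ≡ true → r x z ≡ true)

2Eqfin : Structure 2EqSig → Set
2Eqfin 𝔅 =
  Finite 𝔅
  × IsEquivRel (λ x y → rel 𝔅 P (x ∷ y ∷ []))
  × IsEquivRel (λ x y → rel 𝔅 Q (x ∷ y ∷ []))

-- Encode a bipartite graph (A, E) with two equivalence relations P and Q.
-- Every vertex a is an element whose P-class is labelled a and whose Q-class
-- is that of the parameter p_L or p_R according to its side.  Every ordered
-- pair (a, b) gets a gadget s, r, k forming a Q-class of its own, where s is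
-- P-equivalent to a, r to b, and k to the parameter p_E or p_N according to
-- whether a and b are adjacent.  As p_L and p_R share a P-class, the vertices
-- are the elements Q-equivalent to p_L or p_R but not P-equivalent to p_L, and
-- for distinct a and b both adjacency and non-adjacency are witnessed by a
-- gadget, so all formulas of the scheme are existential.
module Submission where

open import Defs
open import Data.Nat using (ℕ; _+_; _*_)
open import Data.Fin as Fin using (Fin; zero; suc; #_)
open import Data.Fin.Properties using (+↔⊎; *↔×)
open import Data.Vec using (Vec; []; _∷_; _++_; map)
open import Data.Vec.Relation.Unary.All using (All; []; _∷_)
open import Data.Bool as Bool using (Bool; true; false; not; _∨_)
open import Data.Bool.Properties using (∨-comm; ∨-identityʳ; not-¬; ¬-not)
open import Data.Unit as Unit using (⊤; tt)
open import Data.Product using (Σ; _×_; _,_; proj₁; proj₂)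
import Data.Product.Properties as Product
open import Data.Product.Function.NonDependent.Propositional using (_×-↔_)
open import Data.Sum using (_⊎_; inj₁; inj₂)
import Data.Sum.Properties as Sum
open import Data.Sum.Function.Propositional using (_⊎-↔_)
open import Data.Empty using (⊥-elim)
open import Function.Base using (_∘_; _∋_; case_of_)
open import Function.Bundles using (_⇔_; _↔_; mk⇔; module Equivalence)
open import Function.Construct.Composition using (_⇔-∘_)
open import Function.Properties.Inverse using (↔-sym; ↔-trans; ↔-refl; ↔⇒↣)
open import Relation.Nullary using (¬_; Dec; does; yes; no)
open import Relation.Nullary.Decidable using (dec-true; via-injection)
open import Relation.Binary.Definitions using (DecidableEquality)
open import Relation.Binary.PropositionalEquality
  using (_≡_; _≢_; refl; sym; trans; cong)

open Equivalence using (to; from)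

private
  variable
    X Y : Set
    m n : ℕ

does-true : (x? : Dec X) → does x? ≡ true → X
does-true (yes x) _ = x
does-true (no _) ()

kernel-isEquivRel : (_≟_ : DecidableEquality X) (f : Y → X) →
                    IsEquivRel (λ u v → does (f u ≟ f v))
kernel-isEquivRel _≟_ f =
    (λ u → dec-true (f u ≟ f u) refl)
  , (λ u v e → dec-true (f v ≟ f u) (sym (does-true (f u ≟ f v) e)))
  , (λ u v w e e′ → dec-true (f u ≟ f w)
                      (trans (does-true (f u ≟ f v) e) (does-true (f v ≟ f w) e′)))

↔Fin⇒≟ : X ↔ Fin n → DecidableEquality X
↔Fin⇒≟ X↔Fin = via-injection (↔⇒↣ X↔Fin) Fin._≟_

↔Fin-⊎ : X ↔ Fin m → Y ↔ Fin n → (X ⊎ Y) ↔ Fin (m + n)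
↔Fin-⊎ X↔Fin Y↔Fin = ↔-trans (X↔Fin ⊎-↔ Y↔Fin) (↔-sym +↔⊎)

↔Fin-× : X ↔ Fin m → Y ↔ Fin n → (X × Y) ↔ Fin (m * n)
↔Fin-× X↔Fin Y↔Fin = ↔-trans (X↔Fin ×-↔ Y↔Fin) (↔-sym *↔×)

bool-complement : ∀ {x t} → (x ≡ t) ⇔ X → (x ≡ not t) ⇔ Y → Y ⇔ (¬ X)
bool-complement ⇔X ⇔Y =
  mk⇔ (λ y x → not-¬ (from ⇔X x) (from ⇔Y y))
      (λ ¬x → to ⇔Y (¬-not (¬x ∘ to ⇔X)))

∨≡false⇒ˡ : ∀ x {y} → x ∨ y ≡ false → x ≡ false
∨≡false⇒ˡ false _ = refl
∨≡false⇒ˡ true ()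

P' Q' : Fin n → Fin n → Formula 2EqSig n
P' i j = atom P (i ∷ j ∷ [])
Q' i j = atom Q (i ∷ j ∷ [])

-- The parameters are p_L, p_R, p_E, p_N in this order.  Variables of a
-- gadget formula: k, r, s, x₁, x₂, p_L, p_R, p_E, p_N; the last argument is
-- p_E or p_N.
gadget : Fin 9 → Formula 2EqSig 9
gadget t =
  P' (# 3) (# 2) ∧' (Q' (# 2) (# 1) ∧' (P' (# 1) (# 4) ∧' (Q' (# 2) (# 0) ∧' P' (# 0) t)))

gadget-QF : (t : Fin 9) → QF (gadget t)
gadget-QF t =
  qf-and (qf-atom _ _) (qf-and (qf-atom _ _) (qf-and (qf-atom _ _)
    (qf-and (qf-atom _ _) (qf-atom _ _))))

-- A Σ₁-formula needs at least one existential quantifier, hence the unused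
-- outermost variables in φU and in the formulas for L and R.
φU : Formula 2EqSig 5
φU = ∃' ((Q' (# 1) (# 2) ∨' Q' (# 1) (# 3)) ∧' (¬' P' (# 1) (# 2)))

φR φ¬R : (s : BiGSym) → Formula 2EqSig (arity BiGSig s + 4)
φR L = ∃' Q' (# 1) (# 2)
φR R = ∃' Q' (# 1) (# 3)
φR E = ∃' ∃' ∃' (Q' (# 3) (# 5) ∧' ((¬' ((# 3) ≐ (# 4))) ∧' gadget (# 7)))
φ¬R L = φR R
φ¬R R = φR L
φ¬R E = ∃' ∃' ∃' (Q' (# 3) (# 6) ∨' (((# 3) ≐ (# 4)) ∨' gadget (# 8)))

scheme : Scheme 2EqSig BiGSig 4
scheme = record { ΦU = φU ; ΦR = φR ; Φ¬R = φ¬R }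

scheme-Σ₁ : SchemeΣ₁ scheme
scheme-Σ₁ =
    Σ₁-base (qf-and (qf-or (qf-atom _ _) (qf-atom _ _)) (qf-neg (qf-atom _ _)))
  , formulas-Σ₁
  where
  formulas-Σ₁ : (s : BiGSym) → IsΣ₁ (φR s) × IsΣ₁ (φ¬R s)
  formulas-Σ₁ L = Σ₁-base (qf-atom _ _) , Σ₁-base (qf-atom _ _)
  formulas-Σ₁ R = Σ₁-base (qf-atom _ _) , Σ₁-base (qf-atom _ _)
  formulas-Σ₁ E =
      Σ₁-step (Σ₁-step (Σ₁-base
        (qf-and (qf-atom _ _) (qf-and (qf-neg (qf-eq _ _)) (gadget-QF _)))))
    , Σ₁-step (Σ₁-step (Σ₁-base (qf-or (qf-atom _ _) (qf-or (qf-eq _ _) (gadget-QF _)))))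

pattern vertex a = inj₁ a
pattern tail a b = inj₂ (inj₁ (a , b))
pattern head a b = inj₂ (inj₂ (inj₁ (a , b)))
pattern tag a b = inj₂ (inj₂ (inj₂ (inj₁ (a , b))))
pattern p-left = inj₂ (inj₂ (inj₂ (inj₂ zero)))
pattern p-right = inj₂ (inj₂ (inj₂ (inj₂ (suc zero))))
pattern p-edge = inj₂ (inj₂ (inj₂ (inj₂ (suc (suc zero)))))
pattern p-nonedge = inj₂ (inj₂ (inj₂ (inj₂ (suc (suc (suc zero))))))

pattern flag t = inj₂ (inj₁ t)
pattern none = inj₂ (inj₂ tt)

flag-injective : ∀ {t t′} → (X ⊎ Bool ⊎ ⊤ ∋ flag t) ≡ flag t′ → t ≡ t′
flag-injective refl = refl

module Encoding
  (𝔄 : Structure BiGSig) (_≟_ : DecidableEquality (Carrier 𝔄))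
  (L⇔¬R : (x : Carrier 𝔄) →
          (rel 𝔄 L (x ∷ []) ≡ true) ⇔ (¬ rel 𝔄 R (x ∷ []) ≡ true))
  (E⇒L×R : (x y : Carrier 𝔄) → rel 𝔄 E (x ∷ y ∷ []) ≡ true →
           (rel 𝔄 L (x ∷ []) ≡ true) × (rel 𝔄 R (y ∷ []) ≡ true))
  where

  A : Set
  A = Carrier 𝔄

  left right : A → Bool
  left a = rel 𝔄 L (a ∷ [])
  right a = rel 𝔄 R (a ∷ [])

  edge adjacent : A → A → Bool
  edge a b = rel 𝔄 E (a ∷ b ∷ [])
  adjacent a b = edge a b ∨ edge b a

  right⇔¬left : ∀ a → (right a ≡ true) ⇔ (left a ≡ false)
  right⇔¬left a =
    mk⇔ (λ r → ¬-not (λ l → to (L⇔¬R a) l r))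
        (λ l → ¬-not (λ r → not-¬ (from (L⇔¬R a) (λ r′ → not-¬ r′ r)) l))

  edge⇒left : ∀ {a b} → edge a b ≡ true → left a ≡ true
  edge⇒left e = proj₁ (E⇒L×R _ _ e)

  edge⇒¬left : ∀ {a b} → edge a b ≡ true → left b ≡ false
  edge⇒¬left e = to (right⇔¬left _) (proj₂ (E⇒L×R _ _ e))

  edge-irreflexive : ∀ a → edge a a ≡ false
  edge-irreflexive a = ¬-not (λ e → not-¬ (edge⇒left e) (edge⇒¬left e))

  ¬left⇒¬edge : ∀ {a b} → left a ≡ false → edge a b ≡ false
  ¬left⇒¬edge l = ¬-not (λ e → not-¬ (edge⇒left e) l)

  adjacent-left : ∀ {a b} → left a ≡ true → adjacent a b ≡ edge a b
  adjacent-left {a} {b} l =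
    trans (cong (edge a b ∨_) (¬-not (λ e → not-¬ l (edge⇒¬left e))))
          (∨-identityʳ (edge a b))

  adjacent-covered : ∀ {a b c d} → a ≢ b → a ≡ c ⊎ a ≡ d → b ≡ c ⊎ b ≡ d →
                     adjacent c d ≡ adjacent a b
  adjacent-covered a≢b (inj₁ refl) (inj₁ refl) = ⊥-elim (a≢b refl)
  adjacent-covered a≢b (inj₁ refl) (inj₂ refl) = refl
  adjacent-covered {a} {b} a≢b (inj₂ refl) (inj₁ refl) = ∨-comm (edge b a) (edge a b)
  adjacent-covered a≢b (inj₂ refl) (inj₂ refl) = ⊥-elim (a≢b refl)

  Universe : Set
  Universe = A ⊎ A × A ⊎ A × A ⊎ A × A ⊎ Fin 4

  PClass QClass : Set
  PClass = A ⊎ Bool ⊎ ⊤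
  QClass = A × A ⊎ Bool ⊎ ⊤

  _≟P_ : DecidableEquality PClass
  _≟P_ = Sum.≡-dec _≟_ (Sum.≡-dec Bool._≟_ Unit._≟_)

  _≟Q_ : DecidableEquality QClass
  _≟Q_ = Sum.≡-dec (Product.≡-dec _≟_ _≟_) (Sum.≡-dec Bool._≟_ Unit._≟_)

  -- The tag of a gadget records adjacency in either direction, so that the
  -- gadgets of (a, b) and (b, a) agree; the direction of an edge is recovered
  -- from the side of its first vertex.
  pclass : Universe → PClass
  pclass (vertex a) = inj₁ a
  pclass (tail a b) = inj₁ a
  pclass (head a b) = inj₁ b
  pclass (tag a b) = flag (adjacent a b)
  pclass p-left = none
  pclass p-right = none
  pclass p-edge = flag true
  pclass p-nonedge = flag false

  qclass : Universe → QClass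
  qclass (vertex a) = flag (left a)
  qclass (tail a b) = inj₁ (a , b)
  qclass (head a b) = inj₁ (a , b)
  qclass (tag a b) = inj₁ (a , b)
  qclass p-left = flag true
  qclass p-right = flag false
  qclass p-edge = none
  qclass p-nonedge = none

  relation : (s : EqSym) → Vec Universe 2 → Bool
  relation P (u ∷ v ∷ []) = does (pclass u ≟P pclass v)
  relation Q (u ∷ v ∷ []) = does (qclass u ≟Q qclass v)

  𝔅 : Structure 2EqSig
  𝔅 = record { Carrier = Universe ; rel = relation }

  𝔅-2Eqfin : Finite 𝔄 → 2Eqfin 𝔅
  𝔅-2Eqfin (k , A↔Fin) =
      (_ , ↔Fin-⊎ A↔Fin (↔Fin-⊎ A²↔Fin (↔Fin-⊎ A²↔Fin (↔Fin-⊎ A²↔Fin ↔-refl))))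
    , kernel-isEquivRel _≟P_ pclass
    , kernel-isEquivRel _≟Q_ qclass
    where
    A²↔Fin : (A × A) ↔ Fin (k * k)
    A²↔Fin = ↔Fin-× A↔Fin A↔Fin

  parameters : Vec Universe 4
  parameters = p-left ∷ p-right ∷ p-edge ∷ p-nonedge ∷ []

  _~P_ _~Q_ : Universe → Universe → Set
  u ~P v = does (pclass u ≟P pclass v) ≡ true
  u ~Q v = does (qclass u ≟Q qclass v) ≡ true

  ~P⇒≡ : ∀ u v → u ~P v → pclass u ≡ pclass v
  ~P⇒≡ u v = does-true (pclass u ≟P pclass v)

  ≡⇒~P : ∀ u v → pclass u ≡ pclass v → u ~P v
  ≡⇒~P u v = dec-true (pclass u ≟P pclass v)

  ~Q⇒≡ : ∀ u v → u ~Q v → qclass u ≡ qclass v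
  ~Q⇒≡ u v = does-true (qclass u ≟Q qclass v)

  ≡⇒~Q : ∀ u v → qclass u ≡ qclass v → u ~Q v
  ≡⇒~Q u v = dec-true (qclass u ≟Q qclass v)

  vertex-side : ∀ a u {t} → qclass u ≡ flag t → (left a ≡ t) ⇔ (vertex a ~Q u)
  vertex-side a u u-side =
    mk⇔ (λ a-side → ≡⇒~Q (vertex a) u (trans (cong flag a-side) (sym u-side)))
        (λ a~u → flag-injective (trans (~Q⇒≡ (vertex a) u a~u) u-side))

  InU : Universe → Set
  InU u = Sat 𝔅 φU (u ∷ parameters)

  vertex-InU : ∀ a → InU (vertex a)
  vertex-InU a =
    vertex a , on-side (left a) refl , λ a~p → case ~P⇒≡ (vertex a) p-left a~p of λ ()
    where
    on-side : ∀ t → left a ≡ t → vertex a ~Q p-left ⊎ vertex a ~Q p-right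
    on-side true a-side = inj₁ (to (vertex-side a p-left refl) a-side)
    on-side false a-side = inj₂ (to (vertex-side a p-right refl) a-side)

  side-class⇒vertex : ∀ u {t} → qclass u ≡ flag t → pclass u ≢ none →
                      Σ A λ a → vertex a ≡ u
  side-class⇒vertex (vertex a) _ _ = a , refl
  side-class⇒vertex (tail a b) () _
  side-class⇒vertex (head a b) () _
  side-class⇒vertex (tag a b) () _
  side-class⇒vertex p-left _ u≢none = ⊥-elim (u≢none refl)
  side-class⇒vertex p-right _ u≢none = ⊥-elim (u≢none refl)
  side-class⇒vertex p-edge () _
  side-class⇒vertex p-nonedge () _

  InU⇒vertex : ∀ u → InU u → Σ A λ a → vertex a ≡ u
  InU⇒vertex u (_ , inj₁ u~p , u≁p) =
    side-class⇒vertex u (~Q⇒≡ u p-left u~p) (u≁p ∘ ≡⇒~P u p-left)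
  InU⇒vertex u (_ , inj₂ u~p , u≁p) =
    side-class⇒vertex u (~Q⇒≡ u p-right u~p) (u≁p ∘ ≡⇒~P u p-left)

  L-defined : ∀ a → (left a ≡ true) ⇔ Sat 𝔅 (φR L) (vertex a ∷ parameters)
  L-defined a = mk⇔ (λ a-side → vertex a , to (vertex-side a p-left refl) a-side)
                    (from (vertex-side a p-left refl) ∘ proj₂)

  R-defined : ∀ a → (left a ≡ false) ⇔ Sat 𝔅 (φR R) (vertex a ∷ parameters)
  R-defined a = mk⇔ (λ a-side → vertex a , to (vertex-side a p-right refl) a-side)
                    (from (vertex-side a p-right refl) ∘ proj₂)

  Gadget : Universe → Universe → Universe → Universe → Universe → Universe → Set
  Gadget u v w s r k = u ~P s × s ~Q r × r ~P v × s ~Q k × k ~P w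

  gadget-of : ∀ a b w → pclass w ≡ flag (adjacent a b) →
              Gadget (vertex a) (vertex b) w (tail a b) (head a b) (tag a b)
  gadget-of a b w w-flag =
      ≡⇒~P (vertex a) (tail a b) refl , ≡⇒~Q (tail a b) (head a b) refl
    , ≡⇒~P (head a b) (vertex b) refl , ≡⇒~Q (tail a b) (tag a b) refl
    , ≡⇒~P (tag a b) w (sym w-flag)

  end-of-pair : ∀ s {a c d} → pclass s ≡ inj₁ a → qclass s ≡ inj₁ (c , d) →
                a ≡ c ⊎ a ≡ d
  end-of-pair (vertex _) _ ()
  end-of-pair (tail _ _) refl refl = inj₁ refl
  end-of-pair (head _ _) refl refl = inj₂ refl
  end-of-pair (tag _ _) () _
  end-of-pair p-left () _
  end-of-pair p-right () _
  end-of-pair p-edge () _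
  end-of-pair p-nonedge () _

  none-class-¬vertex : ∀ u {a} → qclass u ≡ none → pclass u ≢ inj₁ a
  none-class-¬vertex (vertex _) ()
  none-class-¬vertex (tail _ _) ()
  none-class-¬vertex (head _ _) ()
  none-class-¬vertex (tag _ _) ()
  none-class-¬vertex p-left ()
  none-class-¬vertex p-right ()
  none-class-¬vertex p-edge _ ()
  none-class-¬vertex p-nonedge _ ()

  tag-pair : ∀ k u {a t} → pclass k ≡ flag t → qclass k ≡ qclass u →
             pclass u ≡ inj₁ a →
             Σ A λ c → Σ A λ d → qclass k ≡ inj₁ (c , d) × adjacent c d ≡ t
  tag-pair (vertex _) _ () _ _
  tag-pair (tail _ _) _ () _ _
  tag-pair (head _ _) _ () _ _
  tag-pair (tag c d) _ k-flag _ _ = c , d , refl , flag-injective k-flag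
  tag-pair p-left _ () _ _
  tag-pair p-right _ () _ _
  tag-pair p-edge u _ k~u u-vertex = ⊥-elim (none-class-¬vertex u (sym k~u) u-vertex)
  tag-pair p-nonedge u _ k~u u-vertex = ⊥-elim (none-class-¬vertex u (sym k~u) u-vertex)

  -- The two ends must differ: a single end of the gadget for (a, d) already
  -- links a to itself.
  gadget-sound : ∀ {a b t} w s r k → a ≢ b → pclass w ≡ flag t →
                 Gadget (vertex a) (vertex b) w s r k → adjacent a b ≡ t
  gadget-sound {a} {b} {t} w s r k a≢b w-flag (a~s , s~r , r~b , s~k , k~w) =
    let c , d , k-pair , cd-adjacent = tag-pair k s k-flag (sym s≈k) (sym a≈s)
        a-end = end-of-pair s (sym a≈s) (trans s≈k k-pair)
        b-end = end-of-pair r r≈b (trans (sym s≈r) (trans s≈k k-pair))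
    in trans (sym (adjacent-covered a≢b a-end b-end)) cd-adjacent
    where
    a≈s : inj₁ a ≡ pclass s
    a≈s = ~P⇒≡ (vertex a) s a~s
    r≈b : pclass r ≡ inj₁ b
    r≈b = ~P⇒≡ r (vertex b) r~b
    s≈r : qclass s ≡ qclass r
    s≈r = ~Q⇒≡ s r s~r
    s≈k : qclass s ≡ qclass k
    s≈k = ~Q⇒≡ s k s~k
    k-flag : pclass k ≡ flag t
    k-flag = trans (~P⇒≡ k w k~w) w-flag

  E-complete : ∀ {a b} → edge a b ≡ true →
               Sat 𝔅 (φR E) (vertex a ∷ vertex b ∷ parameters)
  E-complete {a} {b} ab =
      tail a b , head a b , tag a b
    , to (vertex-side a p-left refl) (edge⇒left ab)
    , (λ { refl → not-¬ ab (edge-irreflexive a) })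
    , gadget-of a b p-edge (cong flag (sym (trans (adjacent-left (edge⇒left ab)) ab)))

  E-sound : ∀ {a b} → Sat 𝔅 (φR E) (vertex a ∷ vertex b ∷ parameters) →
            edge a b ≡ true
  E-sound {a} (s , r , k , a~p , a≢b , g) =
    trans (sym (adjacent-left (from (vertex-side a p-left refl) a~p)))
          (gadget-sound p-edge s r k (a≢b ∘ cong vertex) refl g)

  ¬E-complete : ∀ {a b} → edge a b ≡ false →
                Sat 𝔅 (φ¬R E) (vertex a ∷ vertex b ∷ parameters)
  ¬E-complete {a} {b} ¬ab with left a Bool.≟ true | a ≟ b
  ... | no a-right | _ =
    vertex a , vertex a , vertex a , inj₁ (to (vertex-side a p-right refl) (¬-not a-right))
  ... | yes _ | yes refl = vertex a , vertex a , vertex a , inj₂ (inj₁ refl)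
  ... | yes a-side | no a≢b =
    tail a b , head a b , tag a b
    , inj₂ (inj₂ (gadget-of a b p-nonedge
                   (cong flag (sym (trans (adjacent-left a-side) ¬ab)))))

  ¬E-sound : ∀ {a b} → Sat 𝔅 (φ¬R E) (vertex a ∷ vertex b ∷ parameters) →
             edge a b ≡ false
  ¬E-sound {a} (_ , _ , _ , inj₁ a~p) =
    ¬left⇒¬edge (from (vertex-side a p-right refl) a~p)
  ¬E-sound {a} (_ , _ , _ , inj₂ (inj₁ refl)) = edge-irreflexive a
  ¬E-sound {a} {b} (s , r , k , inj₂ (inj₂ g)) with a ≟ b
  ... | yes refl = edge-irreflexive a
  ... | no a≢b = ∨≡false⇒ˡ (edge a b) (gadget-sound p-nonedge s r k a≢b refl g)

  interprets : A → Interprets scheme 𝔄 𝔅 parameters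
  interprets a₀ =
      (vertex a₀ , vertex-InU a₀)
    , complements
    , (vertex , Sum.inj₁-injective , vertex-InU , InU⇒vertex , defines)
    where
    complements : (s : BiGSym) (us : Vec Universe (arity BiGSig s)) → All InU us →
                  Sat 𝔅 (φ¬R s) (us ++ parameters) ⇔ (¬ Sat 𝔅 (φR s) (us ++ parameters))
    complements L (u ∷ []) (u∈U ∷ []) with InU⇒vertex u u∈U
    ... | a , refl = bool-complement (L-defined a) (R-defined a)
    complements R (u ∷ []) (u∈U ∷ []) with InU⇒vertex u u∈U
    ... | a , refl = bool-complement (R-defined a) (L-defined a)
    complements E (u ∷ v ∷ []) (u∈U ∷ v∈U ∷ [])
      with InU⇒vertex u u∈U | InU⇒vertex v v∈U
    ... | a , refl | b , refl =
      bool-complement (mk⇔ E-complete E-sound) (mk⇔ ¬E-complete ¬E-sound)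

    defines : (s : BiGSym) (as : Vec A (arity BiGSig s)) →
              (rel 𝔄 s as ≡ true) ⇔ Sat 𝔅 (φR s) (map vertex as ++ parameters)
    defines L (a ∷ []) = L-defined a
    defines R (a ∷ []) = R-defined a ⇔-∘ right⇔¬left a
    defines E (a ∷ b ∷ []) = mk⇔ E-complete E-sound

lemma2 : Σ₁-InterpretableWithParams BiG*fin 2Eqfin
lemma2 = 4 , scheme , scheme-Σ₁ , λ where
  𝔄 (A-finite@(_ , A↔Fin) , L⇔¬R , E⇒L×R , (a₀ , _) , _) →
    let open Encoding 𝔄 (↔Fin⇒≟ A↔Fin) L⇔¬R E⇒L×R
    in 𝔅 , 𝔅-2Eqfin A-finite , parameters , interprets a₀
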